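{- Let $S[1\ldots n]$ be a string and $k$ a position. If $S[i\ldots j]$ is a longest repeat covering position $k$, then $S[i\ldots j]$ is the left-bounded longest repeat starting at position $i$.
   Context: For a string $S[1\ldots n]$, $S[i\ldots j]=S[i]\cdots S[j]$, which covers position $k$ if $i\le k\le j$. A substring $S[i\ldots j]$ is unique if there is no other substring $S[i'\ldots j']$ equal to it with $i'\neq i$; a repeat is a non-unique substring. A longest repeat covering $k$ is a repeat $S[i\ldots j]$ with $i\le k\le j$ such that no repeat $S[i'\ldots j']$ with $i'\le k\le j'$ has $j'-i'>j-i$. The left-bounded longest repeat starting at position $i$ is the repeat $S[i\ldots j]$ such that either $j=n$ or $S[i\ldots j+1]$ is unique. -}

module Defs where

open import Data.Nat using (ℕ; suc; _≤_; _∸_; _<_)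
open import Data.List using (List; length; take; drop)
open import Data.Product using (_×_; Σ; ∃; ∃-syntax)
open import Data.Sum using (_⊎_)
open import Relation.Binary.PropositionalEquality using (_≡_; _≢_)
open import Relation.Nullary using (¬_)

-- Strings are lists over an arbitrary alphabet A; positions are 1-based:
-- S[1 … n] with n = length S.

Valid : {A : Set} → List A → ℕ → ℕ → Set
Valid S i j = 1 ≤ i × i ≤ j × j ≤ length S

-- The substring S[i … j] = S[i] ⋯ S[j] (meaningful when Valid S i j).
sub : {A : Set} → List A → ℕ → ℕ → List A
sub S i j = take (suc j ∸ i) (drop (i ∸ 1) S)

Repeat : {A : Set} → List A → ℕ → ℕ → Set
Repeat S i j = Valid S i j ×
  ∃[ i' ] ∃[ j' ] (Valid S i' j' × i' ≢ i × sub S i' j' ≡ sub S i j)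

Unique : {A : Set} → List A → ℕ → ℕ → Set
Unique S i j = Valid S i j ×
  ¬ (∃[ i' ] ∃[ j' ] (Valid S i' j' × i' ≢ i × sub S i' j' ≡ sub S i j))

Covers : ℕ → ℕ → ℕ → Set
Covers i j k = i ≤ k × k ≤ j

LongestRepeatCovering : {A : Set} → List A → ℕ → ℕ → ℕ → Set
LongestRepeatCovering S k i j =
  Repeat S i j × Covers i j k ×
  (∀ i' j' → Repeat S i' j' → Covers i' j' k → ¬ (j ∸ i < j' ∸ i'))

LeftBoundedLongestRepeat : {A : Set} → List A → ℕ → ℕ → Set
LeftBoundedLongestRepeat S i j =
  Repeat S i j × (j ≡ length S ⊎ Unique S i (suc j))

module Submission where

open import Defs
open import Data.Nat using (ℕ; suc; _<_; _∸_)
open import Data.Nat.Properties using (m≤n⇒m<n∨m≡n; m≤n⇒m≤1+n; n<1+n; ∸-monoˡ-<)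
open import Data.List using (List; length)
open import Data.Product using (_,_)
open import Data.Sum using (inj₁; inj₂)

valid-extendʳ : {A : Set} (S : List A) {i j : ℕ} →
  Valid S i j → j < length S → Valid S i (suc j)
valid-extendʳ S (1≤i , i≤j , _) j<n = 1≤i , m≤n⇒m≤1+n i≤j , j<n

covers-extendʳ : {i j k : ℕ} → Covers i j k → Covers i (suc j) k
covers-extendʳ (i≤k , k≤j) = i≤k , m≤n⇒m≤1+n k≤j

-- S[i … j+1] still covers k and is strictly longer, so maximality of S[i … j] forbids it to be a repeat.
longestRepeatCovering-extendʳ-unique : {A : Set} (S : List A) {k i j : ℕ} →
  LongestRepeatCovering S k i j → j < length S → Unique S i (suc j)
longestRepeatCovering-extendʳ-unique S {k} {i} {j}
  ((valid@(_ , i≤j , _) , _) , covers , longest) j<n =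
  valid′ , λ other → longest i (suc j) (valid′ , other) (covers-extendʳ covers) longer
  where
    valid′ : Valid S i (suc j)
    valid′ = valid-extendʳ S valid j<n

    longer : j ∸ i < suc j ∸ i
    longer = ∸-monoˡ-< (n<1+n j) i≤j

lemma2 : {A : Set} (S : List A) (k i j : ℕ) →
    LongestRepeatCovering S k i j → LeftBoundedLongestRepeat S i j
lemma2 S k i j lrc@(repeat@((_ , _ , j≤n) , _) , _) with m≤n⇒m<n∨m≡n j≤n
... | inj₂ j≡n = repeat , inj₁ j≡n
... | inj₁ j<n = repeat , inj₂ (longestRepeatCovering-extendʳ-unique S lrc j<n)
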